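{- Let $t, u$ be CBN/CBV terms and $s'$ a Bang term. (Stability) If $t^{n} \to_{I}^{*} s'$, then there is a term $s$ with $s^{n} = s'$ (resp. if $t^{v} \to_{I}^{*} s'$ and $s'$ is a normal form for the internal $\mathtt{d!}$-reduction, then there is a term $s$ with $s^{v} = s'$). (Normal Forms) $t$ is a normal form for CBN internal reduction $\to_{I}$ (resp. for CBV internal reduction $\to_{I}$) iff $t^{n}$ (resp. $t^{v}$) is a normal form for Bang internal reduction $\to_{I}$. (Simulations) $t \to_{I}^{*} u$ in CBN (resp. in CBV) iff $t^{n} \to_{I}^{*} u^{n}$ (resp. $t^{v} \to_{I}^{*} u^{v}$) in Bang. Moreover, the number of $\mathtt{dB}/\mathtt{s}$-steps (resp. $\mathtt{dB}/\mathtt{sV}$-steps) on the left matches the number of $\mathtt{dB}/\mathtt{s!}$-steps on the right.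
   Context: Distant Bang Calculus: terms $t,u ::= x \mid t\,u \mid \lambda x.t \mid\, !t \mid \mathrm{der}(t) \mid t[x\backslash u]$ (explicit substitution $t[x\backslash u]$ binds $x$ in $t$). Full contexts $F ::= \diamond \mid F\,t \mid t\,F \mid \lambda x.F \mid\, !F \mid \mathrm{der}(F) \mid F[x\backslash t] \mid t[x\backslash F]$; surface contexts $S$ are the same but without $!S$ (hole not under a $!$); list contexts $L ::= \diamond \mid L[x\backslash t]$. Rewrite rules (capture-free): $(L\langle\lambda x.t\rangle)\,u \mapsto_{\mathtt{dB}} L\langle t[x\backslash u]\rangle$; $t[x\backslash L\langle !u\rangle] \mapsto_{\mathtt{s!}} L\langle t\{x:=u\}\rangle$; $\mathrm{der}(L\langle !t\rangle) \mapsto_{\mathtt{d!}} L\langle t\rangle$, where $t\{x:=u\}$ is meta-level substitution. Bang internal contexts $I ::= \,!F \mid S^{*}\langle I\rangle$ with $S^{*}$ a surface context different from $\diamond$; Bang internal reduction $\to_I$ is the closure of the three rules under internal contexts, and internal $\mathtt{d!}$-reduction is the closure of rule $\mathtt{d!}$ alone under internal contexts. CBN/CBV calculi: terms $t,u ::= v \mid t\,u \mid t[x\backslash u]$, values $v ::= x \mid \lambda x.t$; full contexts $F ::= \diamond \mid F\,t \mid t\,F \mid \lambda x.F \mid F[x\backslash t] \mid t[x\backslash F]$, list contexts $L ::= \diamond \mid L[x\backslash t]$. CBN rules: $(L\langle\lambda x.t\rangle)\,u \mapsto_{\mathtt{dB}} L\langle t[x\backslash u]\rangle$ and $t[x\backslash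 u] \mapsto_{\mathtt{s}} t\{x:=u\}$. CBV rules: the same $\mathtt{dB}$ and $t[x\backslash L\langle v\rangle] \mapsto_{\mathtt{sV}} L\langle t\{x:=v\}\rangle$. CBN surface contexts $S ::= \diamond \mid S\,t \mid \lambda x.S \mid S[x\backslash t]$; CBN internal contexts $I ::= t\,F \mid t[x\backslash F] \mid S^{*}\langle I\rangle$ ($S^{*}$ a non-empty CBN surface context). CBV surface contexts $S ::= \diamond \mid S\,t \mid t\,S \mid S[x\backslash t] \mid t[x\backslash S]$; CBV internal contexts $I ::= \lambda x.F \mid S^{*}\langle I\rangle$ ($S^{*}$ a non-empty CBV surface context). CBN (resp. CBV) internal reduction $\to_I$ is the closure of the CBN (resp. CBV) rules under CBN (resp. CBV) internal contexts. CBN embedding: $x^{n} = x$, $(\lambda x.t)^{n} = \lambda x.t^{n}$, $(t\,u)^{n} = t^{n}\,!u^{n}$, $(t[x\backslash u])^{n} = t^{n}[x\backslash !u^{n}]$. CBV embedding: $x^{v} = \,!x$, $(\lambda x.t)^{v} = \,!\lambda x.!t^{v}$, $(t\,u)^{v} = \mathrm{der}(L\langle s\rangle\, u^{v})$ if $t^{v} = L\langle !s\rangle$ for some list context $L$, and $(t\,u)^{v} = \mathrm{der}(\mathrm{der}(t^{v})\, u^{v})$ otherwise; $(t[x\backslash u])^{v} = t^{v}[x\backslash u^{v}]$. -}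

module Defs where

open import Data.Nat using (ℕ; zero; suc; _+_)
open import Data.List using (List; []; _∷_; length)
open import Data.Product using (Σ; ∃; ∃-syntax; _×_; _,_)
open import Data.Maybe using (Maybe; just; nothing)
open import Relation.Binary.PropositionalEquality using (_≡_; _≢_)
open import Relation.Nullary using (¬_)

-- Terms use de Bruijn indices (so syntactic equality is α-equivalence and
-- all substitutions are capture-free).  In  es t u  (= t[x\u]) the
-- variable x is index 0 in t, and u lies outside the binder.

data Star {A L : Set} (R : A → L → A → Set) : A → List L → A → Set where
  ε   : ∀ {a} → Star R a [] a
  _◅_ : ∀ {a l b ls c} → R a l b → Star R b ls c → Star R a (l ∷ ls) c

infixr 5 _◅_

data BTm : Set where
  var  : ℕ → BTm
  app  : BTm → BTm → BTm
  lam  : BTm → BTm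
  bang : BTm → BTm
  der  : BTm → BTm
  es   : BTm → BTm → BTm

brename : (ℕ → ℕ) → BTm → BTm
bext : (ℕ → ℕ) → ℕ → ℕ
bext ρ zero = zero
bext ρ (suc n) = suc (ρ n)
brename ρ (var n) = var (ρ n)
brename ρ (app t u) = app (brename ρ t) (brename ρ u)
brename ρ (lam t) = lam (brename (bext ρ) t)
brename ρ (bang t) = bang (brename ρ t)
brename ρ (der t) = der (brename ρ t)
brename ρ (es t u) = es (brename (bext ρ) t) (brename ρ u)

bexts : (ℕ → BTm) → ℕ → BTm
bexts σ zero = var zero
bexts σ (suc n) = brename suc (σ n)

bsubst : (ℕ → BTm) → BTm → BTm
bsubst σ (var n) = σ n
bsubst σ (app t u) = app (bsubst σ t) (bsubst σ u)
bsubst σ (lam t) = lam (bsubst (bexts σ) t)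
bsubst σ (bang t) = bang (bsubst σ t)
bsubst σ (der t) = der (bsubst σ t)
bsubst σ (es t u) = es (bsubst (bexts σ) t) (bsubst σ u)

bshift : ℕ → BTm → BTm
bshift k = brename (k +_)

-- t{x:=u} where t is under the binder x (index 0) and the result is
-- placed under k further binders (those of a list context) which u is
-- already under.
bsub0 : ℕ → BTm → BTm → BTm
bsub0 k t u = bsubst σ t
  where σ : ℕ → BTm
        σ zero = u
        σ (suc n) = var (k + n)

-- List contexts L ::= ◇ | L[x\t]; the head of the list is the outermost ES.
BL : Set
BL = List BTm

plugBL : BL → BTm → BTm
plugBL [] t = t
plugBL (u ∷ L) t = es (plugBL L t) u

data BF : Set where
  hole : BF
  appL : BF → BTm → BF
  appR : BTm → BF → BF
  lam  : BF → BF
  bang : BF → BF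
  der  : BF → BF
  esL  : BF → BTm → BF
  esR  : BTm → BF → BF

plugBF : BF → BTm → BTm
plugBF hole t = t
plugBF (appL F u) t = app (plugBF F t) u
plugBF (appR u F) t = app u (plugBF F t)
plugBF (lam F) t = lam (plugBF F t)
plugBF (bang F) t = bang (plugBF F t)
plugBF (der F) t = der (plugBF F t)
plugBF (esL F u) t = es (plugBF F t) u
plugBF (esR u F) t = es u (plugBF F t)

data BS : Set where
  hole : BS
  appL : BS → BTm → BS
  appR : BTm → BS → BS
  lam  : BS → BS
  der  : BS → BS
  esL  : BS → BTm → BS
  esR  : BTm → BS → BS

plugBS : BS → BTm → BTm
plugBS hole t = t
plugBS (appL S u) t = app (plugBS S t) u
plugBS (appR u S) t = app u (plugBS S t)
plugBS (lam S) t = lam (plugBS S t)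
plugBS (der S) t = der (plugBS S t)
plugBS (esL S u) t = es (plugBS S t) u
plugBS (esR u S) t = es u (plugBS S t)

data BI : Set where
  bangF : BF → BI
  surf  : (S : BS) → S ≢ hole → BI → BI

plugBI : BI → BTm → BTm
plugBI (bangF F) t = bang (plugBF F t)
plugBI (surf S _ I) t = plugBS S (plugBI I t)

data BKind : Set where
  bdB bs! bd! : BKind

data BRoot : BKind → BTm → BTm → Set where
  rdB : ∀ (L : BL) t u →
        BRoot bdB (app (plugBL L (lam t)) u) (plugBL L (es t (bshift (length L) u)))
  rs! : ∀ (L : BL) t u →
        BRoot bs! (es t (plugBL L (bang u))) (plugBL L (bsub0 (length L) t u))
  rd! : ∀ (L : BL) t →
        BRoot bd! (der (plugBL L (bang t))) (plugBL L t)

data _⟶BI[_]_ : BTm → BKind → BTm → Set where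
  step : ∀ (I : BI) {k t u} → BRoot k t u → plugBI I t ⟶BI[ k ] plugBI I u

BStar : BTm → List BKind → BTm → Set
BStar = Star _⟶BI[_]_

BNF : BTm → Set
BNF t = ∀ k u → ¬ (t ⟶BI[ k ] u)

BNF-d! : BTm → Set
BNF-d! t = ∀ u → ¬ (t ⟶BI[ bd! ] u)

data Tm : Set where
  var : ℕ → Tm
  app : Tm → Tm → Tm
  lam : Tm → Tm
  es  : Tm → Tm → Tm

data Value : Tm → Set where
  var : ∀ n → Value (var n)
  lam : ∀ t → Value (lam t)

rename : (ℕ → ℕ) → Tm → Tm
rename ρ (var n) = var (ρ n)
rename ρ (app t u) = app (rename ρ t) (rename ρ u)
rename ρ (lam t) = lam (rename (bext ρ) t)
rename ρ (es t u) = es (rename (bext ρ) t) (rename ρ u)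

exts : (ℕ → Tm) → ℕ → Tm
exts σ zero = var zero
exts σ (suc n) = rename suc (σ n)

subst : (ℕ → Tm) → Tm → Tm
subst σ (var n) = σ n
subst σ (app t u) = app (subst σ t) (subst σ u)
subst σ (lam t) = lam (subst (exts σ) t)
subst σ (es t u) = es (subst (exts σ) t) (subst σ u)

shift : ℕ → Tm → Tm
shift k = rename (k +_)

sub0 : ℕ → Tm → Tm → Tm
sub0 k t u = subst σ t
  where σ : ℕ → Tm
        σ zero = u
        σ (suc n) = var (k + n)

LC : Set
LC = List Tm

plugL : LC → Tm → Tm
plugL [] t = t
plugL (u ∷ L) t = es (plugL L t) u

data F : Set where
  hole : F
  appL : F → Tm → F
  appR : Tm → F → F
  lam  : F → F
  esL  : F → Tm → F
  esR  : Tm → F → F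

plugF : F → Tm → Tm
plugF hole t = t
plugF (appL C u) t = app (plugF C t) u
plugF (appR u C) t = app u (plugF C t)
plugF (lam C) t = lam (plugF C t)
plugF (esL C u) t = es (plugF C t) u
plugF (esR u C) t = es u (plugF C t)

data NKind : Set where
  ndB ns : NKind

data NRoot : NKind → Tm → Tm → Set where
  rdB : ∀ (L : LC) t u →
        NRoot ndB (app (plugL L (lam t)) u) (plugL L (es t (shift (length L) u)))
  rs  : ∀ t u → NRoot ns (es t u) (sub0 0 t u)

data NS : Set where
  hole : NS
  appL : NS → Tm → NS
  lam  : NS → NS
  esL  : NS → Tm → NS

plugNS : NS → Tm → Tm
plugNS hole t = t
plugNS (appL S u) t = app (plugNS S t) u
plugNS (lam S) t = lam (plugNS S t)
plugNS (esL S u) t = es (plugNS S t) u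

data NI : Set where
  appRF : Tm → F → NI
  esRF  : Tm → F → NI
  surf  : (S : NS) → S ≢ hole → NI → NI

plugNI : NI → Tm → Tm
plugNI (appRF u C) t = app u (plugF C t)
plugNI (esRF u C) t = es u (plugF C t)
plugNI (surf S _ I) t = plugNS S (plugNI I t)

data _⟶NI[_]_ : Tm → NKind → Tm → Set where
  step : ∀ (I : NI) {k t u} → NRoot k t u → plugNI I t ⟶NI[ k ] plugNI I u

NStar : Tm → List NKind → Tm → Set
NStar = Star _⟶NI[_]_

NNF : Tm → Set
NNF t = ∀ k u → ¬ (t ⟶NI[ k ] u)

data VKind : Set where
  vdB vsV : VKind

data VRoot : VKind → Tm → Tm → Set where
  rdB : ∀ (L : LC) t u →
        VRoot vdB (app (plugL L (lam t)) u) (plugL L (es t (shift (length L) u)))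
  rsV : ∀ (L : LC) t v → Value v →
        VRoot vsV (es t (plugL L v)) (plugL L (sub0 (length L) t v))

data VS : Set where
  hole : VS
  appL : VS → Tm → VS
  appR : Tm → VS → VS
  esL  : VS → Tm → VS
  esR  : Tm → VS → VS

plugVS : VS → Tm → Tm
plugVS hole t = t
plugVS (appL S u) t = app (plugVS S t) u
plugVS (appR u S) t = app u (plugVS S t)
plugVS (esL S u) t = es (plugVS S t) u
plugVS (esR u S) t = es u (plugVS S t)

data VI : Set where
  lamF : F → VI
  surf : (S : VS) → S ≢ hole → VI → VI

plugVI : VI → Tm → Tm
plugVI (lamF C) t = lam (plugF C t)
plugVI (surf S _ I) t = plugVS S (plugVI I t)

data _⟶VI[_]_ : Tm → VKind → Tm → Set where
  step : ∀ (I : VI) {k t u} → VRoot k t u → plugVI I t ⟶VI[ k ] plugVI I u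

VStar : Tm → List VKind → Tm → Set
VStar = Star _⟶VI[_]_

VNF : Tm → Set
VNF t = ∀ k u → ¬ (t ⟶VI[ k ] u)

_ⁿ : Tm → BTm
var n ⁿ = var n
lam t ⁿ = lam (t ⁿ)
app t u ⁿ = app (t ⁿ) (bang (u ⁿ))
es t u ⁿ = es (t ⁿ) (bang (u ⁿ))

splitBang : BTm → Maybe (BL × BTm)
splitBang (bang s) = just ([] , s)
splitBang (es t u) with splitBang t
... | just (L , s) = just (u ∷ L , s)
... | nothing = nothing
splitBang _ = nothing

appV : BTm → BTm → BTm
appV tv uv with splitBang tv
... | just (L , s) = der (app (plugBL L s) uv)
... | nothing = der (app (der tv) uv)

_ᵛ : Tm → BTm
var n ᵛ = bang (var n)
lam t ᵛ = bang (lam (bang (t ᵛ)))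
app t u ᵛ = appV (t ᵛ) (u ᵛ)
es t u ᵛ = es (t ᵛ) (u ᵛ)

cntB : BKind → List BKind → ℕ
cntB k [] = 0
cntB bdB (bdB ∷ ks) = suc (cntB bdB ks)
cntB bs! (bs! ∷ ks) = suc (cntB bs! ks)
cntB bd! (bd! ∷ ks) = suc (cntB bd! ks)
cntB k (_ ∷ ks) = cntB k ks

cntN : NKind → List NKind → ℕ
cntN k [] = 0
cntN ndB (ndB ∷ ks) = suc (cntN ndB ks)
cntN ns (ns ∷ ks) = suc (cntN ns ks)
cntN k (_ ∷ ks) = cntN k ks

cntV : VKind → List VKind → ℕ
cntV k [] = 0
cntV vdB (vdB ∷ ks) = suc (cntV vdB ks)
cntV vsV (vsV ∷ ks) = suc (cntV vsV ks)
cntV k (_ ∷ ks) = cntV k ks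

-- For each embedding, an inductive relation between Bang terms and CBN/CBV terms is a
-- step-by-step bisimulation for internal reduction (viewed as a congruence closure).
--
-- For CBN the relation is the graph of ⁿ.  The positions where CBN internal reduction
-- may fire (arguments and ES contents, at any depth) are exactly those that ⁿ puts
-- under a bang, so steps correspond one to one, dB to dB and s to s!.
--
-- For CBV the graph of ᵛ is not closed under reduction: a dB-step on
-- der ((L⟨λx.!tᵛ⟩) uᵛ) leaves der (L⟨!tᵛ⟩[x\uᵛ]), an administrative d!-redex.
-- The relation therefore also admits such pending redexes below a bang.  Every
-- internal Bang step from a related term either contracts one (invisible in CBV) or
-- mirrors a dB/sV-step by a dB/s!-step; conversely pending redexes can always be
-- contracted by internal d!-steps, which leads back to the exact image of a CBV term.

module Submission where

open import Defs
open import Data.Nat using (ℕ; zero; suc; _+_)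
open import Data.List using (List; []; _∷_; length; map)
open import Data.Maybe using (just; nothing)
open import Data.Product using (∃-syntax; _×_; _,_)
open import Data.Unit using (⊤; tt)
open import Data.Empty using (⊥-elim)
open import Relation.Nullary using (¬_; Dec; yes; no)
open import Relation.Binary.PropositionalEquality using (_≡_; refl; sym; trans; cong; cong₂)
open import Function.Bundles using (_⇔_; mk⇔)
open import Relation.Binary.Construct.Closure.ReflexiveTransitive as RT using (ε; _◅_; _◅◅_; gmap)

-- A full step may happen anywhere; an internal one only at the positions allowed by
-- the internal contexts: under a bang (Bang), in an argument or ES content (CBN),
-- under a λ (CBV).
data Mode : Set where
  full internal : Mode

data BStep : Mode → BTm → BKind → BTm → Set where
  root   : ∀ {k s s₁} → BRoot k s s₁ → BStep full s k s₁
  ξ-bang : ∀ {m k s s₁} → BStep full s k s₁ → BStep m (bang s) k (bang s₁)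
  ξ-appL : ∀ {m k s s₁ u} → BStep m s k s₁ → BStep m (app s u) k (app s₁ u)
  ξ-appR : ∀ {m k s u u₁} → BStep m u k u₁ → BStep m (app s u) k (app s u₁)
  ξ-lam  : ∀ {m k s s₁} → BStep m s k s₁ → BStep m (lam s) k (lam s₁)
  ξ-der  : ∀ {m k s s₁} → BStep m s k s₁ → BStep m (der s) k (der s₁)
  ξ-esL  : ∀ {m k s s₁ u} → BStep m s k s₁ → BStep m (es s u) k (es s₁ u)
  ξ-esR  : ∀ {m k s u u₁} → BStep m u k u₁ → BStep m (es s u) k (es s u₁)

data BFullStep : BTm → BKind → BTm → Set where
  plug : ∀ {k s s₁} (C : BF) → BRoot k s s₁ → BFullStep (plugBF C s) k (plugBF C s₁)

plugBF-step : ∀ {k s s₁} (C : BF) → BRoot k s s₁ → BStep full (plugBF C s) k (plugBF C s₁)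
plugBF-step hole r = root r
plugBF-step (appL C u) r = ξ-appL (plugBF-step C r)
plugBF-step (appR u C) r = ξ-appR (plugBF-step C r)
plugBF-step (lam C) r = ξ-lam (plugBF-step C r)
plugBF-step (bang C) r = ξ-bang (plugBF-step C r)
plugBF-step (der C) r = ξ-der (plugBF-step C r)
plugBF-step (esL C u) r = ξ-esL (plugBF-step C r)
plugBF-step (esR u C) r = ξ-esR (plugBF-step C r)

plugBS-step : ∀ {k s s₁} (S : BS) → BStep internal s k s₁ → BStep internal (plugBS S s) k (plugBS S s₁)
plugBS-step hole st = st
plugBS-step (appL S u) st = ξ-appL (plugBS-step S st)
plugBS-step (appR u S) st = ξ-appR (plugBS-step S st)
plugBS-step (lam S) st = ξ-lam (plugBS-step S st)
plugBS-step (der S) st = ξ-der (plugBS-step S st)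
plugBS-step (esL S u) st = ξ-esL (plugBS-step S st)
plugBS-step (esR u S) st = ξ-esR (plugBS-step S st)

⟶BI⇒BStep : ∀ {k s s₁} → s ⟶BI[ k ] s₁ → BStep internal s k s₁
⟶BI⇒BStep (step I r) = go I r
  where
  go : ∀ {k s s₁} (I : BI) → BRoot k s s₁ → BStep internal (plugBI I s) k (plugBI I s₁)
  go (bangF C) r = ξ-bang (plugBF-step C r)
  go (surf S _ I) r = plugBS-step S (go I r)

BStep⇒BFullStep : ∀ {k s s₁} → BStep full s k s₁ → BFullStep s k s₁
BStep⇒BFullStep (root r) = plug hole r
BStep⇒BFullStep (ξ-bang st) with BStep⇒BFullStep st
... | plug C r = plug (bang C) r
BStep⇒BFullStep (ξ-appL {u = u} st) with BStep⇒BFullStep st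
... | plug C r = plug (appL C u) r
BStep⇒BFullStep (ξ-appR {s = s} st) with BStep⇒BFullStep st
... | plug C r = plug (appR s C) r
BStep⇒BFullStep (ξ-lam st) with BStep⇒BFullStep st
... | plug C r = plug (lam C) r
BStep⇒BFullStep (ξ-der st) with BStep⇒BFullStep st
... | plug C r = plug (der C) r
BStep⇒BFullStep (ξ-esL {u = u} st) with BStep⇒BFullStep st
... | plug C r = plug (esL C u) r
BStep⇒BFullStep (ξ-esR {s = s} st) with BStep⇒BFullStep st
... | plug C r = plug (esR s C) r

BStep⇒⟶BI : ∀ {k s s₁} → BStep internal s k s₁ → s ⟶BI[ k ] s₁
BStep⇒⟶BI (ξ-bang st) with BStep⇒BFullStep st
... | plug C r = step (bangF C) r
BStep⇒⟶BI (ξ-appL {u = u} st) with BStep⇒⟶BI st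
... | step I r = step (surf (appL hole u) (λ ()) I) r
BStep⇒⟶BI (ξ-appR {s = s} st) with BStep⇒⟶BI st
... | step I r = step (surf (appR s hole) (λ ()) I) r
BStep⇒⟶BI (ξ-lam st) with BStep⇒⟶BI st
... | step I r = step (surf (lam hole) (λ ()) I) r
BStep⇒⟶BI (ξ-der st) with BStep⇒⟶BI st
... | step I r = step (surf (der hole) (λ ()) I) r
BStep⇒⟶BI (ξ-esL {u = u} st) with BStep⇒⟶BI st
... | step I r = step (surf (esL hole u) (λ ()) I) r
BStep⇒⟶BI (ξ-esR {s = s} st) with BStep⇒⟶BI st
... | step I r = step (surf (esR s hole) (λ ()) I) r

data NStep : Mode → Tm → NKind → Tm → Set where
  root   : ∀ {k t t₁} → NRoot k t t₁ → NStep full t k t₁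
  ξ-appL : ∀ {m k t t₁ u} → NStep m t k t₁ → NStep m (app t u) k (app t₁ u)
  ξ-appR : ∀ {m k t u u₁} → NStep full u k u₁ → NStep m (app t u) k (app t u₁)
  ξ-lam  : ∀ {m k t t₁} → NStep m t k t₁ → NStep m (lam t) k (lam t₁)
  ξ-esL  : ∀ {m k t t₁ u} → NStep m t k t₁ → NStep m (es t u) k (es t₁ u)
  ξ-esR  : ∀ {m k t u u₁} → NStep full u k u₁ → NStep m (es t u) k (es t u₁)

data NFullStep : Tm → NKind → Tm → Set where
  plug : ∀ {k t t₁} (C : F) → NRoot k t t₁ → NFullStep (plugF C t) k (plugF C t₁)

plugF-NStep : ∀ {k t t₁} (C : F) → NRoot k t t₁ → NStep full (plugF C t) k (plugF C t₁)
plugF-NStep hole r = root r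
plugF-NStep (appL C u) r = ξ-appL (plugF-NStep C r)
plugF-NStep (appR u C) r = ξ-appR (plugF-NStep C r)
plugF-NStep (lam C) r = ξ-lam (plugF-NStep C r)
plugF-NStep (esL C u) r = ξ-esL (plugF-NStep C r)
plugF-NStep (esR u C) r = ξ-esR (plugF-NStep C r)

plugNS-step : ∀ {k t t₁} (S : NS) → NStep internal t k t₁ → NStep internal (plugNS S t) k (plugNS S t₁)
plugNS-step hole st = st
plugNS-step (appL S u) st = ξ-appL (plugNS-step S st)
plugNS-step (lam S) st = ξ-lam (plugNS-step S st)
plugNS-step (esL S u) st = ξ-esL (plugNS-step S st)

⟶NI⇒NStep : ∀ {k t t₁} → t ⟶NI[ k ] t₁ → NStep internal t k t₁
⟶NI⇒NStep (step I r) = go I r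
  where
  go : ∀ {k t t₁} (I : NI) → NRoot k t t₁ → NStep internal (plugNI I t) k (plugNI I t₁)
  go (appRF u C) r = ξ-appR (plugF-NStep C r)
  go (esRF u C) r = ξ-esR (plugF-NStep C r)
  go (surf S _ I) r = plugNS-step S (go I r)

NStep⇒NFullStep : ∀ {k t t₁} → NStep full t k t₁ → NFullStep t k t₁
NStep⇒NFullStep (root r) = plug hole r
NStep⇒NFullStep (ξ-appL {u = u} st) with NStep⇒NFullStep st
... | plug C r = plug (appL C u) r
NStep⇒NFullStep (ξ-appR {t = t} st) with NStep⇒NFullStep st
... | plug C r = plug (appR t C) r
NStep⇒NFullStep (ξ-lam st) with NStep⇒NFullStep st
... | plug C r = plug (lam C) r
NStep⇒NFullStep (ξ-esL {u = u} st) with NStep⇒NFullStep st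
... | plug C r = plug (esL C u) r
NStep⇒NFullStep (ξ-esR {t = t} st) with NStep⇒NFullStep st
... | plug C r = plug (esR t C) r

NStep⇒⟶NI : ∀ {k t t₁} → NStep internal t k t₁ → t ⟶NI[ k ] t₁
NStep⇒⟶NI (ξ-appR {t = t} st) with NStep⇒NFullStep st
... | plug C r = step (appRF t C) r
NStep⇒⟶NI (ξ-esR {t = t} st) with NStep⇒NFullStep st
... | plug C r = step (esRF t C) r
NStep⇒⟶NI (ξ-appL {u = u} st) with NStep⇒⟶NI st
... | step I r = step (surf (appL hole u) (λ ()) I) r
NStep⇒⟶NI (ξ-lam st) with NStep⇒⟶NI st
... | step I r = step (surf (lam hole) (λ ()) I) r
NStep⇒⟶NI (ξ-esL {u = u} st) with NStep⇒⟶NI st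
... | step I r = step (surf (esL hole u) (λ ()) I) r

data VStep : Mode → Tm → VKind → Tm → Set where
  root   : ∀ {k t t₁} → VRoot k t t₁ → VStep full t k t₁
  ξ-lam  : ∀ {m k t t₁} → VStep full t k t₁ → VStep m (lam t) k (lam t₁)
  ξ-appL : ∀ {m k t t₁ u} → VStep m t k t₁ → VStep m (app t u) k (app t₁ u)
  ξ-appR : ∀ {m k t u u₁} → VStep m u k u₁ → VStep m (app t u) k (app t u₁)
  ξ-esL  : ∀ {m k t t₁ u} → VStep m t k t₁ → VStep m (es t u) k (es t₁ u)
  ξ-esR  : ∀ {m k t u u₁} → VStep m u k u₁ → VStep m (es t u) k (es t u₁)

data VFullStep : Tm → VKind → Tm → Set where
  plug : ∀ {k t t₁} (C : F) → VRoot k t t₁ → VFullStep (plugF C t) k (plugF C t₁)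

plugF-VStep : ∀ {k t t₁} (C : F) → VRoot k t t₁ → VStep full (plugF C t) k (plugF C t₁)
plugF-VStep hole r = root r
plugF-VStep (appL C u) r = ξ-appL (plugF-VStep C r)
plugF-VStep (appR u C) r = ξ-appR (plugF-VStep C r)
plugF-VStep (lam C) r = ξ-lam (plugF-VStep C r)
plugF-VStep (esL C u) r = ξ-esL (plugF-VStep C r)
plugF-VStep (esR u C) r = ξ-esR (plugF-VStep C r)

plugVS-step : ∀ {k t t₁} (S : VS) → VStep internal t k t₁ → VStep internal (plugVS S t) k (plugVS S t₁)
plugVS-step hole st = st
plugVS-step (appL S u) st = ξ-appL (plugVS-step S st)
plugVS-step (appR u S) st = ξ-appR (plugVS-step S st)
plugVS-step (esL S u) st = ξ-esL (plugVS-step S st)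
plugVS-step (esR u S) st = ξ-esR (plugVS-step S st)

⟶VI⇒VStep : ∀ {k t t₁} → t ⟶VI[ k ] t₁ → VStep internal t k t₁
⟶VI⇒VStep (step I r) = go I r
  where
  go : ∀ {k t t₁} (I : VI) → VRoot k t t₁ → VStep internal (plugVI I t) k (plugVI I t₁)
  go (lamF C) r = ξ-lam (plugF-VStep C r)
  go (surf S _ I) r = plugVS-step S (go I r)

VStep⇒VFullStep : ∀ {k t t₁} → VStep full t k t₁ → VFullStep t k t₁
VStep⇒VFullStep (root r) = plug hole r
VStep⇒VFullStep (ξ-lam st) with VStep⇒VFullStep st
... | plug C r = plug (lam C) r
VStep⇒VFullStep (ξ-appL {u = u} st) with VStep⇒VFullStep st
... | plug C r = plug (appL C u) r
VStep⇒VFullStep (ξ-appR {t = t} st) with VStep⇒VFullStep st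
... | plug C r = plug (appR t C) r
VStep⇒VFullStep (ξ-esL {u = u} st) with VStep⇒VFullStep st
... | plug C r = plug (esL C u) r
VStep⇒VFullStep (ξ-esR {t = t} st) with VStep⇒VFullStep st
... | plug C r = plug (esR t C) r

VStep⇒⟶VI : ∀ {k t t₁} → VStep internal t k t₁ → t ⟶VI[ k ] t₁
VStep⇒⟶VI (ξ-lam st) with VStep⇒VFullStep st
... | plug C r = step (lamF C) r
VStep⇒⟶VI (ξ-appL {u = u} st) with VStep⇒⟶VI st
... | step I r = step (surf (appL hole u) (λ ()) I) r
VStep⇒⟶VI (ξ-appR {t = t} st) with VStep⇒⟶VI st
... | step I r = step (surf (appR t hole) (λ ()) I) r
VStep⇒⟶VI (ξ-esL {u = u} st) with VStep⇒⟶VI st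
... | step I r = step (surf (esL hole u) (λ ()) I) r
VStep⇒⟶VI (ξ-esR {t = t} st) with VStep⇒⟶VI st
... | step I r = step (surf (esR t hole) (λ ()) I) r

data Embⁿ : BTm → Tm → Set where
  var : ∀ n → Embⁿ (var n) (var n)
  lam : ∀ {s t} → Embⁿ s t → Embⁿ (lam s) (lam t)
  app : ∀ {s t s′ u} → Embⁿ s t → Embⁿ s′ u → Embⁿ (app s (bang s′)) (app t u)
  es  : ∀ {s t s′ u} → Embⁿ s t → Embⁿ s′ u → Embⁿ (es s (bang s′)) (es t u)

Embⁿ-ⁿ : ∀ t → Embⁿ (t ⁿ) t
Embⁿ-ⁿ (var n) = var n
Embⁿ-ⁿ (app t u) = app (Embⁿ-ⁿ t) (Embⁿ-ⁿ u)
Embⁿ-ⁿ (lam t) = lam (Embⁿ-ⁿ t)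
Embⁿ-ⁿ (es t u) = es (Embⁿ-ⁿ t) (Embⁿ-ⁿ u)

Embⁿ⇒≡ⁿ : ∀ {s t} → Embⁿ s t → s ≡ t ⁿ
Embⁿ⇒≡ⁿ (var n) = refl
Embⁿ⇒≡ⁿ (lam p) = cong lam (Embⁿ⇒≡ⁿ p)
Embⁿ⇒≡ⁿ (app p q) = cong₂ (λ a b → app a (bang b)) (Embⁿ⇒≡ⁿ p) (Embⁿ⇒≡ⁿ q)
Embⁿ⇒≡ⁿ (es p q) = cong₂ (λ a b → es a (bang b)) (Embⁿ⇒≡ⁿ p) (Embⁿ⇒≡ⁿ q)

Embⁿ-functional : ∀ {s t t′} → Embⁿ s t → Embⁿ s t′ → t ≡ t′
Embⁿ-functional (var n) (var .n) = refl
Embⁿ-functional (lam p) (lam p′) = cong lam (Embⁿ-functional p p′)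
Embⁿ-functional (app p q) (app p′ q′) = cong₂ app (Embⁿ-functional p p′) (Embⁿ-functional q q′)
Embⁿ-functional (es p q) (es p′ q′) = cong₂ es (Embⁿ-functional p p′) (Embⁿ-functional q q′)

Embⁿ-rename : ∀ {s t} (ρ : ℕ → ℕ) → Embⁿ s t → Embⁿ (brename ρ s) (rename ρ t)
Embⁿ-rename ρ (var n) = var (ρ n)
Embⁿ-rename ρ (lam p) = lam (Embⁿ-rename (bext ρ) p)
Embⁿ-rename ρ (app p q) = app (Embⁿ-rename ρ p) (Embⁿ-rename ρ q)
Embⁿ-rename ρ (es p q) = es (Embⁿ-rename (bext ρ) p) (Embⁿ-rename ρ q)

Embⁿ-exts : ∀ {σ τ} → (∀ n → Embⁿ (σ n) (τ n)) → ∀ n → Embⁿ (bexts σ n) (exts τ n)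
Embⁿ-exts h zero = var zero
Embⁿ-exts h (suc n) = Embⁿ-rename suc (h n)

Embⁿ-subst : ∀ {σ τ s t} → (∀ n → Embⁿ (σ n) (τ n)) → Embⁿ s t → Embⁿ (bsubst σ s) (subst τ t)
Embⁿ-subst h (var n) = h n
Embⁿ-subst h (lam p) = lam (Embⁿ-subst (Embⁿ-exts h) p)
Embⁿ-subst h (app p q) = app (Embⁿ-subst h p) (Embⁿ-subst h q)
Embⁿ-subst h (es p q) = es (Embⁿ-subst (Embⁿ-exts h) p) (Embⁿ-subst h q)

Embⁿ-sub0 : ∀ {s t s′ u} k → Embⁿ s t → Embⁿ s′ u → Embⁿ (bsub0 k s s′) (sub0 k t u)
Embⁿ-sub0 k p q = Embⁿ-subst h p
  where
  h : ∀ n → Embⁿ _ _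
  h zero = q
  h (suc n) = var (k + n)

data Embⁿᴸ : BL → LC → Set where
  []  : Embⁿᴸ [] []
  _∷_ : ∀ {s t L L′} → Embⁿ s t → Embⁿᴸ L L′ → Embⁿᴸ (bang s ∷ L) (t ∷ L′)

Embⁿ-plugL : ∀ {L L′ s t} → Embⁿᴸ L L′ → Embⁿ s t → Embⁿ (plugBL L s) (plugL L′ t)
Embⁿ-plugL [] p = p
Embⁿ-plugL (q ∷ l) p = es (Embⁿ-plugL l p) q

Embⁿᴸ-length : ∀ {L L′} → Embⁿᴸ L L′ → length L ≡ length L′
Embⁿᴸ-length [] = refl
Embⁿᴸ-length (_ ∷ l) = cong suc (Embⁿᴸ-length l)

data LamUnderⁿ (L : BL) (s : BTm) : Tm → Set where
  lamUnder : ∀ {L′ t} → Embⁿᴸ L L′ → Embⁿ s t → LamUnderⁿ L s (plugL L′ (lam t))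

Embⁿ-plugBL-lam⁻¹ : ∀ (L : BL) {s t} → Embⁿ (plugBL L (lam s)) t → LamUnderⁿ L s t
Embⁿ-plugBL-lam⁻¹ [] (lam p) = lamUnder [] p
Embⁿ-plugBL-lam⁻¹ (_ ∷ L) (es p q) with Embⁿ-plugBL-lam⁻¹ L p
... | lamUnder l r = lamUnder (q ∷ l) r

data LamUnderⁿᴮ (L : LC) (t : Tm) : BTm → Set where
  lamUnder : ∀ {L′ s} → Embⁿᴸ L′ L → Embⁿ s t → LamUnderⁿᴮ L t (plugBL L′ (lam s))

Embⁿ-plugL-lam⁻¹ : ∀ (L : LC) {s t} → Embⁿ s (plugL L (lam t)) → LamUnderⁿᴮ L t s
Embⁿ-plugL-lam⁻¹ [] (lam p) = lamUnder [] p
Embⁿ-plugL-lam⁻¹ (_ ∷ L) (es p q) with Embⁿ-plugL-lam⁻¹ L p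
... | lamUnder l r = lamUnder (q ∷ l) r

toBKindⁿ : NKind → BKind
toBKindⁿ ndB = bdB
toBKindⁿ ns = bs!

data Reflectⁿ (m : Mode) (t : Tm) : BKind → BTm → Set where
  reflect : ∀ {k t₁ s₁} → NStep m t k t₁ → Embⁿ s₁ t₁ → Reflectⁿ m t (toBKindⁿ k) s₁

reflect-rootⁿ : ∀ {k s s₁ t} → BRoot k s s₁ → Embⁿ s t → Reflectⁿ full t k s₁
reflect-rootⁿ (rdB L _ _) (app {u = u} p q) with Embⁿ-plugBL-lam⁻¹ L p
... | lamUnder {L′} {t₀} l r rewrite Embⁿᴸ-length l =
  reflect (root (rdB L′ t₀ u)) (Embⁿ-plugL l (es r (Embⁿ-rename (length L′ +_) q)))
reflect-rootⁿ (rs! [] _ _) (es p q) = reflect (root (rs _ _)) (Embⁿ-sub0 0 p q)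

reflectⁿ : ∀ {m s k s₁ t} → Embⁿ s t → BStep m s k s₁ → Reflectⁿ m t k s₁
reflectⁿ p (root r) = reflect-rootⁿ r p
reflectⁿ (lam p) (ξ-lam st) with reflectⁿ p st
... | reflect nst r = reflect (ξ-lam nst) (lam r)
reflectⁿ (app p q) (ξ-appL st) with reflectⁿ p st
... | reflect nst r = reflect (ξ-appL nst) (app r q)
reflectⁿ (app p q) (ξ-appR (ξ-bang st)) with reflectⁿ q st
... | reflect nst r = reflect (ξ-appR nst) (app p r)
reflectⁿ (es p q) (ξ-esL st) with reflectⁿ p st
... | reflect nst r = reflect (ξ-esL nst) (es r q)
reflectⁿ (es p q) (ξ-esR (ξ-bang st)) with reflectⁿ q st
... | reflect nst r = reflect (ξ-esR nst) (es p r)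

simulateⁿ : ∀ {m s t k t₁} → Embⁿ s t → NStep m t k t₁ →
            ∃[ s₁ ] (BStep m s (toBKindⁿ k) s₁ × Embⁿ s₁ t₁)
simulateⁿ (app {s′ = s′} p q) (root (rdB L _ _)) with Embⁿ-plugL-lam⁻¹ L p
... | lamUnder {L′} {s₀} l r rewrite sym (Embⁿᴸ-length l) =
  _ , root (rdB L′ s₀ (bang s′)) , Embⁿ-plugL l (es r (Embⁿ-rename (length L′ +_) q))
simulateⁿ (es p q) (root (rs _ _)) = _ , root (rs! [] _ _) , Embⁿ-sub0 0 p q
simulateⁿ (lam p) (ξ-lam st) with simulateⁿ p st
... | _ , bst , r = _ , ξ-lam bst , lam r
simulateⁿ (app p q) (ξ-appL st) with simulateⁿ p st
... | _ , bst , r = _ , ξ-appL bst , app r q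
simulateⁿ (app p q) (ξ-appR st) with simulateⁿ q st
... | _ , bst , r = _ , ξ-appR (ξ-bang bst) , app p r
simulateⁿ (es p q) (ξ-esL st) with simulateⁿ p st
... | _ , bst , r = _ , ξ-esL bst , es r q
simulateⁿ (es p q) (ξ-esR st) with simulateⁿ q st
... | _ , bst , r = _ , ξ-esR (ξ-bang bst) , es p r

reflectⁿ* : ∀ {s t tr s′} → Embⁿ s t → BStar s tr s′ →
            ∃[ tr₀ ] ∃[ t′ ] (NStar t tr₀ t′ × Embⁿ s′ t′ × tr ≡ map toBKindⁿ tr₀)
reflectⁿ* p ε = [] , _ , ε , p , refl
reflectⁿ* p (st ◅ sts) with reflectⁿ p (⟶BI⇒BStep st)
... | reflect {k} nst r with reflectⁿ* r sts
... | tr₀ , t′ , nsts , r′ , refl = k ∷ tr₀ , t′ , NStep⇒⟶NI nst ◅ nsts , r′ , refl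

simulateⁿ* : ∀ {s t tr u} → Embⁿ s t → NStar t tr u →
             ∃[ s′ ] (BStar s (map toBKindⁿ tr) s′ × Embⁿ s′ u)
simulateⁿ* p ε = _ , ε , p
simulateⁿ* p (st ◅ sts) with simulateⁿ p (⟶NI⇒NStep st)
... | _ , bst , r with simulateⁿ* r sts
... | s′ , bsts , r′ = s′ , BStep⇒⟶BI bst ◅ bsts , r′

cntB-map-toBKindⁿ : ∀ k tr → cntB (toBKindⁿ k) (map toBKindⁿ tr) ≡ cntN k tr
cntB-map-toBKindⁿ k [] = refl
cntB-map-toBKindⁿ ndB (ndB ∷ tr) = cong suc (cntB-map-toBKindⁿ ndB tr)
cntB-map-toBKindⁿ ndB (ns ∷ tr) = cntB-map-toBKindⁿ ndB tr
cntB-map-toBKindⁿ ns (ndB ∷ tr) = cntB-map-toBKindⁿ ns tr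
cntB-map-toBKindⁿ ns (ns ∷ tr) = cong suc (cntB-map-toBKindⁿ ns tr)

CountsMatchⁿ : List BKind → List NKind → Set
CountsMatchⁿ tr′ tr = cntB bdB tr′ ≡ cntN ndB tr × cntB bs! tr′ ≡ cntN ns tr

counts-map-toBKindⁿ : ∀ tr → CountsMatchⁿ (map toBKindⁿ tr) tr
counts-map-toBKindⁿ tr = cntB-map-toBKindⁿ ndB tr , cntB-map-toBKindⁿ ns tr

stabilityⁿ : ∀ (t : Tm) (s′ : BTm) (tr : List BKind) → BStar (t ⁿ) tr s′ → ∃[ s ] s ⁿ ≡ s′
stabilityⁿ t s′ tr sts with reflectⁿ* (Embⁿ-ⁿ t) sts
... | _ , t′ , _ , r , _ = t′ , sym (Embⁿ⇒≡ⁿ r)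

normal-formsⁿ : ∀ (t : Tm) → NNF t ⇔ BNF (t ⁿ)
normal-formsⁿ t = mk⇔ to from
  where
  to : NNF t → BNF (t ⁿ)
  to nf k s st with reflectⁿ (Embⁿ-ⁿ t) (⟶BI⇒BStep st)
  ... | reflect nst _ = nf _ _ (NStep⇒⟶NI nst)
  from : BNF (t ⁿ) → NNF t
  from nf k u st with simulateⁿ (Embⁿ-ⁿ t) (⟶NI⇒NStep st)
  ... | _ , bst , _ = nf _ _ (BStep⇒⟶BI bst)

simulationⁿ : ∀ (t u : Tm) →
  (∀ (tr : List NKind) → NStar t tr u → ∃[ tr′ ] (BStar (t ⁿ) tr′ (u ⁿ) × CountsMatchⁿ tr′ tr))
  × (∀ (tr′ : List BKind) → BStar (t ⁿ) tr′ (u ⁿ) → ∃[ tr ] (NStar t tr u × CountsMatchⁿ tr′ tr))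
simulationⁿ t u = forward , backward
  where
  forward : ∀ tr → NStar t tr u → ∃[ tr′ ] (BStar (t ⁿ) tr′ (u ⁿ) × CountsMatchⁿ tr′ tr)
  forward tr nsts with simulateⁿ* (Embⁿ-ⁿ t) nsts
  ... | _ , bsts , r rewrite Embⁿ⇒≡ⁿ r = map toBKindⁿ tr , bsts , counts-map-toBKindⁿ tr
  backward : ∀ tr′ → BStar (t ⁿ) tr′ (u ⁿ) → ∃[ tr ] (NStar t tr u × CountsMatchⁿ tr′ tr)
  backward tr′ bsts with reflectⁿ* (Embⁿ-ⁿ t) bsts
  ... | tr , _ , nsts , r , refl rewrite Embⁿ-functional r (Embⁿ-ⁿ u) = tr , nsts , counts-map-toBKindⁿ tr

-- The terms whose image is not of the form L⟨!s⟩, i.e. those on which appV takes its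
-- second branch.
data SpineApp : Tm → Set where
  app : ∀ {t u} → SpineApp (app t u)
  es  : ∀ {t u} → SpineApp t → SpineApp (es t u)

SpineApp? : ∀ t → Dec (SpineApp t)
SpineApp? (var n) = no λ ()
SpineApp? (lam t) = no λ ()
SpineApp? (app t u) = yes app
SpineApp? (es t u) with SpineApp? t
... | yes sa = yes (es sa)
... | no ¬sa = no λ { (es sa) → ¬sa sa }

splitBang-plugBL : ∀ L x → splitBang (plugBL L (bang x)) ≡ just (L , x)
splitBang-plugBL [] x = refl
splitBang-plugBL (u ∷ L) x rewrite splitBang-plugBL L x = refl

SpineApp⇒splitBang≡nothing : ∀ {t} → SpineApp t → splitBang (t ᵛ) ≡ nothing
SpineApp⇒splitBang≡nothing {app t u} app with splitBang (t ᵛ)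
... | just _ = refl
... | nothing = refl
SpineApp⇒splitBang≡nothing {es t u} (es sa) rewrite SpineApp⇒splitBang≡nothing sa = refl

-- Embᵛ m canonical s t means s ≡ t ᵛ; with pending, s may moreover contain
-- administrative redexes der s′ with Bangedᵛ pending s′ t′.  The mode says whether the
-- position is under a bang (full), the only place where such redexes can be contracted.
-- Headᵛ relates the function part h of (t u) ᵛ = der (app h (u ᵛ)): either h = der (t ᵛ),
-- or t ᵛ = L⟨!x⟩ and h = L⟨x⟩ (Unbangedᵛ).  A der head over a non-application is itself
-- a pending d!-redex, whence DerHead.
data Form : Set where
  canonical pending : Form

DerHead : Mode → Form → Tm → Set
DerHead m canonical t = SpineApp t
DerHead full pending t = ⊤
DerHead internal pending t = SpineApp t

data Embᵛ : Mode → Form → BTm → Tm → Set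
data Headᵛ : Mode → Form → BTm → Tm → Set
data Unbangedᵛ : Mode → Form → BTm → Tm → Set
data Bangedᵛ : Form → BTm → Tm → Set

data Embᵛ where
  var     : ∀ {m f} n → Embᵛ m f (bang (var n)) (var n)
  lam     : ∀ {m f s t} → Embᵛ full f s t → Embᵛ m f (bang (lam (bang s))) (lam t)
  es      : ∀ {m f s t s′ u} → Embᵛ m f s t → Embᵛ m f s′ u → Embᵛ m f (es s s′) (es t u)
  app     : ∀ {m f h t s′ u} → Headᵛ m f h t → Embᵛ m f s′ u → Embᵛ m f (der (app h s′)) (app t u)
  pending : ∀ {s t} → Bangedᵛ pending s t → Embᵛ full pending (der s) t

data Headᵛ where
  der      : ∀ {m f s t} → Embᵛ m f s t → DerHead m f t → Headᵛ m f (der s) t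
  unbanged : ∀ {m f s t} → Unbangedᵛ m f s t → Headᵛ m f s t

data Unbangedᵛ where
  var : ∀ {m f} n → Unbangedᵛ m f (var n) (var n)
  lam : ∀ {m f s t} → Embᵛ full f s t → Unbangedᵛ m f (lam (bang s)) (lam t)
  es  : ∀ {m f s t s′ u} → Unbangedᵛ m f s t → Embᵛ m f s′ u → Unbangedᵛ m f (es s s′) (es t u)

data Bangedᵛ where
  bang : ∀ {f s t} → Embᵛ full f s t → Bangedᵛ f (bang s) t
  es   : ∀ {f s t s′ u} → Bangedᵛ f s t → Embᵛ full f s′ u → Bangedᵛ f (es s s′) (es t u)

Embᵛ-unbang : ∀ {m f x t} (L : BL) → Embᵛ m f (plugBL L (bang x)) t → Unbangedᵛ m f (plugBL L x) t
Embᵛ-unbang [] (var n) = var n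
Embᵛ-unbang [] (lam r) = lam r
Embᵛ-unbang (_ ∷ L) (es p q) = es (Embᵛ-unbang L p) q

data IsBanged : BTm → Set where
  banged : ∀ L x → IsBanged (plugBL L (bang x))

Embᵛ-isBanged : ∀ {m s t} → Embᵛ m canonical s t → ¬ SpineApp t → IsBanged s
Embᵛ-isBanged (var n) _ = banged [] (var n)
Embᵛ-isBanged (lam _) _ = banged [] _
Embᵛ-isBanged (es {s′ = s′} p _) ¬sa with Embᵛ-isBanged p (λ sa → ¬sa (es sa))
... | banged L x = banged (s′ ∷ L) x
Embᵛ-isBanged (app _ _) ¬sa = ⊥-elim (¬sa app)

Embᵛ-ᵛ : ∀ m t → Embᵛ m canonical (t ᵛ) t
Embᵛ-ᵛ m (var n) = var n
Embᵛ-ᵛ m (lam t) = lam (Embᵛ-ᵛ full t)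
Embᵛ-ᵛ m (es t u) = es (Embᵛ-ᵛ m t) (Embᵛ-ᵛ m u)
Embᵛ-ᵛ m (app t u) with SpineApp? t
... | yes sa rewrite SpineApp⇒splitBang≡nothing sa = app (der (Embᵛ-ᵛ m t) sa) (Embᵛ-ᵛ m u)
... | no ¬sa with t ᵛ | Embᵛ-ᵛ m t
...   | s | r with Embᵛ-isBanged r ¬sa
...     | banged L x rewrite splitBang-plugBL L x = app (unbanged (Embᵛ-unbang L r)) (Embᵛ-ᵛ m u)

canonical⇒≡ᵛ : ∀ {m s t} → Embᵛ m canonical s t → s ≡ t ᵛ
appV-Headᵛ : ∀ {m h t} → Headᵛ m canonical h t → ∀ b → der (app h b) ≡ appV (t ᵛ) b
Unbangedᵛ-canonical : ∀ {m s t} → Unbangedᵛ m canonical s t →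
                      ∃[ L ] ∃[ x ] (t ᵛ ≡ plugBL L (bang x) × s ≡ plugBL L x)

canonical⇒≡ᵛ (var n) = refl
canonical⇒≡ᵛ (lam r) = cong (λ s → bang (lam (bang s))) (canonical⇒≡ᵛ r)
canonical⇒≡ᵛ (es p q) = cong₂ es (canonical⇒≡ᵛ p) (canonical⇒≡ᵛ q)
canonical⇒≡ᵛ (app {u = u} h r) =
  trans (cong (λ b → der (app _ b)) (canonical⇒≡ᵛ r)) (appV-Headᵛ h (u ᵛ))

appV-Headᵛ (der r sa) b rewrite canonical⇒≡ᵛ r | SpineApp⇒splitBang≡nothing sa = refl
appV-Headᵛ (unbanged q) b with Unbangedᵛ-canonical q
... | L , x , eq₁ , eq₂ rewrite eq₁ | eq₂ | splitBang-plugBL L x = refl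

Unbangedᵛ-canonical (var n) = [] , var n , refl , refl
Unbangedᵛ-canonical (lam r) = [] , _ , refl , cong (λ s → lam (bang s)) (canonical⇒≡ᵛ r)
Unbangedᵛ-canonical {t = es t u} (es q r) with Unbangedᵛ-canonical q
... | L , x , eq₁ , eq₂ = u ᵛ ∷ L , x , cong (λ s → es s (u ᵛ)) eq₁ , cong₂ es eq₂ (canonical⇒≡ᵛ r)

Embᵛ-functional : ∀ {m s t t′} → Embᵛ m canonical s t → Embᵛ m canonical s t′ → t ≡ t′
Headᵛ-functional : ∀ {m s t t′} → Headᵛ m canonical s t → Headᵛ m canonical s t′ → t ≡ t′
Unbangedᵛ-functional : ∀ {m s t t′} → Unbangedᵛ m canonical s t → Unbangedᵛ m canonical s t′ → t ≡ t′
Embᵛ-functional (var n) (var .n) = refl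
Embᵛ-functional (lam r) (lam r′) = cong lam (Embᵛ-functional r r′)
Embᵛ-functional (es p q) (es p′ q′) = cong₂ es (Embᵛ-functional p p′) (Embᵛ-functional q q′)
Embᵛ-functional (app h r) (app h′ r′) = cong₂ app (Headᵛ-functional h h′) (Embᵛ-functional r r′)
Headᵛ-functional (der r _) (der r′ _) = Embᵛ-functional r r′
Headᵛ-functional (der _ _) (unbanged ())
Headᵛ-functional (unbanged ()) (der _ _)
Headᵛ-functional (unbanged q) (unbanged q′) = Unbangedᵛ-functional q q′
Unbangedᵛ-functional (var n) (var .n) = refl
Unbangedᵛ-functional (lam r) (lam r′) = cong lam (Embᵛ-functional r r′)
Unbangedᵛ-functional (es q r) (es q′ r′) = cong₂ es (Unbangedᵛ-functional q q′) (Embᵛ-functional r r′)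

DerHead-relax : ∀ m {t} → DerHead m canonical t → DerHead m pending t
DerHead-relax full _ = tt
DerHead-relax internal sa = sa

relax : ∀ {m s t} → Embᵛ m canonical s t → Embᵛ m pending s t
relaxᴴ : ∀ {m s t} → Headᵛ m canonical s t → Headᵛ m pending s t
relaxᵁ : ∀ {m s t} → Unbangedᵛ m canonical s t → Unbangedᵛ m pending s t
relax (var n) = var n
relax (lam r) = lam (relax r)
relax (es p q) = es (relax p) (relax q)
relax (app h r) = app (relaxᴴ h) (relax r)
relaxᴴ {m} (der r sa) = der (relax r) (DerHead-relax m sa)
relaxᴴ (unbanged q) = unbanged (relaxᵁ q)
relaxᵁ (var n) = var n
relaxᵁ (lam r) = lam (relax r)
relaxᵁ (es q r) = es (relaxᵁ q) (relax r)

Embᵛ-banged-¬SpineApp : ∀ {m f x t} (L : BL) → Embᵛ m f (plugBL L (bang x)) t → ¬ SpineApp t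
Embᵛ-banged-¬SpineApp [] (var n) ()
Embᵛ-banged-¬SpineApp [] (lam r) ()
Embᵛ-banged-¬SpineApp (_ ∷ L) (es p q) (es sa) = Embᵛ-banged-¬SpineApp L p sa

canonical-d!-free : ∀ {m s t s₁} → Embᵛ m canonical s t → ¬ BStep m s bd! s₁
canonical-d!-freeᴴ : ∀ {m s t s₁} → Headᵛ m canonical s t → ¬ BStep m s bd! s₁
canonical-d!-freeᵁ : ∀ {m s t s₁} → Unbangedᵛ m canonical s t → ¬ BStep m s bd! s₁
canonical-d!-free p (root r) = no-root-d! r p
  where
  no-root-d! : ∀ {s s₁ t} → BRoot bd! s s₁ → ¬ Embᵛ full canonical s t
  no-root-d! (rd! [] _) ()
  no-root-d! (rd! (_ ∷ _) _) ()
canonical-d!-free (var n) (ξ-bang (root ()))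
canonical-d!-free (lam r) (ξ-bang (root ()))
canonical-d!-free (lam r) (ξ-bang (ξ-lam (root ())))
canonical-d!-free (lam r) (ξ-bang (ξ-lam (ξ-bang st))) = canonical-d!-free r st
canonical-d!-free (es p q) (ξ-esL st) = canonical-d!-free p st
canonical-d!-free (es p q) (ξ-esR st) = canonical-d!-free q st
canonical-d!-free (app h r) (ξ-der (root ()))
canonical-d!-free (app h r) (ξ-der (ξ-appL st)) = canonical-d!-freeᴴ h st
canonical-d!-free (app h r) (ξ-der (ξ-appR st)) = canonical-d!-free r st
canonical-d!-freeᴴ (der r sa) (root (rd! L _)) = Embᵛ-banged-¬SpineApp L r sa
canonical-d!-freeᴴ (der r sa) (ξ-der st) = canonical-d!-free r st
canonical-d!-freeᴴ (unbanged q) st = canonical-d!-freeᵁ q st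
canonical-d!-freeᵁ (var n) (root ())
canonical-d!-freeᵁ (lam r) (root ())
canonical-d!-freeᵁ (lam r) (ξ-lam (root ()))
canonical-d!-freeᵁ (lam r) (ξ-lam (ξ-bang st)) = canonical-d!-free r st
canonical-d!-freeᵁ (es q r) (root ())
canonical-d!-freeᵁ (es q r) (ξ-esL st) = canonical-d!-freeᵁ q st
canonical-d!-freeᵁ (es q r) (ξ-esR st) = canonical-d!-free r st

SpineApp-rename : ∀ {t} (ρ : ℕ → ℕ) → SpineApp t → SpineApp (rename ρ t)
SpineApp-rename ρ app = app
SpineApp-rename ρ (es sa) = es (SpineApp-rename (bext ρ) sa)

SpineApp-subst : ∀ {t} (σ : ℕ → Tm) → SpineApp t → SpineApp (subst σ t)
SpineApp-subst σ app = app
SpineApp-subst σ (es sa) = es (SpineApp-subst (exts σ) sa)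

DerHead-rename : ∀ f {t} (ρ : ℕ → ℕ) → DerHead full f t → DerHead full f (rename ρ t)
DerHead-rename canonical ρ sa = SpineApp-rename ρ sa
DerHead-rename pending ρ _ = tt

DerHead-subst : ∀ f {t} (σ : ℕ → Tm) → DerHead full f t → DerHead full f (subst σ t)
DerHead-subst canonical σ sa = SpineApp-subst σ sa
DerHead-subst pending σ _ = tt

Embᵛ-rename : ∀ {f s t} (ρ : ℕ → ℕ) → Embᵛ full f s t → Embᵛ full f (brename ρ s) (rename ρ t)
Headᵛ-rename : ∀ {f s t} (ρ : ℕ → ℕ) → Headᵛ full f s t → Headᵛ full f (brename ρ s) (rename ρ t)
Unbangedᵛ-rename : ∀ {f s t} (ρ : ℕ → ℕ) →
                   Unbangedᵛ full f s t → Unbangedᵛ full f (brename ρ s) (rename ρ t)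
Bangedᵛ-rename : ∀ {f s t} (ρ : ℕ → ℕ) → Bangedᵛ f s t → Bangedᵛ f (brename ρ s) (rename ρ t)
Embᵛ-rename ρ (var n) = var (ρ n)
Embᵛ-rename ρ (lam r) = lam (Embᵛ-rename (bext ρ) r)
Embᵛ-rename ρ (es p q) = es (Embᵛ-rename (bext ρ) p) (Embᵛ-rename ρ q)
Embᵛ-rename ρ (app h r) = app (Headᵛ-rename ρ h) (Embᵛ-rename ρ r)
Embᵛ-rename ρ (pending p) = pending (Bangedᵛ-rename ρ p)
Headᵛ-rename {f} ρ (der r d) = der (Embᵛ-rename ρ r) (DerHead-rename f ρ d)
Headᵛ-rename ρ (unbanged q) = unbanged (Unbangedᵛ-rename ρ q)
Unbangedᵛ-rename ρ (var n) = var (ρ n)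
Unbangedᵛ-rename ρ (lam r) = lam (Embᵛ-rename (bext ρ) r)
Unbangedᵛ-rename ρ (es q r) = es (Unbangedᵛ-rename (bext ρ) q) (Embᵛ-rename ρ r)
Bangedᵛ-rename ρ (bang r) = bang (Embᵛ-rename ρ r)
Bangedᵛ-rename ρ (es p r) = es (Bangedᵛ-rename (bext ρ) p) (Embᵛ-rename ρ r)

-- Values related without their outer bang: these are what s!-steps substitute.
data Valueᵛ (f : Form) : BTm → Tm → Set where
  var : ∀ n → Valueᵛ f (var n) (var n)
  lam : ∀ {s t} → Embᵛ full f s t → Valueᵛ f (lam (bang s)) (lam t)

Valueᵛ-rename : ∀ {f U v} (ρ : ℕ → ℕ) → Valueᵛ f U v → Valueᵛ f (brename ρ U) (rename ρ v)
Valueᵛ-rename ρ (var n) = var (ρ n)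
Valueᵛ-rename ρ (lam r) = lam (Embᵛ-rename (bext ρ) r)

ValueEnvᵛ : Form → (ℕ → BTm) → (ℕ → Tm) → Set
ValueEnvᵛ f σ τ = ∀ n → Valueᵛ f (σ n) (τ n)

Valueᵛ-exts : ∀ {f σ τ} → ValueEnvᵛ f σ τ → ValueEnvᵛ f (bexts σ) (exts τ)
Valueᵛ-exts h zero = var zero
Valueᵛ-exts h (suc n) = Valueᵛ-rename suc (h n)

Valueᵛ⇒Embᵛ : ∀ {m f U v} → Valueᵛ f U v → Embᵛ m f (bang U) v
Valueᵛ⇒Embᵛ (var n) = var n
Valueᵛ⇒Embᵛ (lam r) = lam r

Valueᵛ⇒Unbangedᵛ : ∀ {m f U v} → Valueᵛ f U v → Unbangedᵛ m f U v
Valueᵛ⇒Unbangedᵛ (var n) = var n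
Valueᵛ⇒Unbangedᵛ (lam r) = lam r

Valueᵛ⇒Value : ∀ {f U v} → Valueᵛ f U v → Value v
Valueᵛ⇒Value (var n) = var n
Valueᵛ⇒Value (lam {t = t} _) = lam t

Embᵛ-subst : ∀ {f σ τ s t} → ValueEnvᵛ f σ τ →
             Embᵛ full f s t → Embᵛ full f (bsubst σ s) (subst τ t)
Headᵛ-subst : ∀ {f σ τ s t} → ValueEnvᵛ f σ τ →
              Headᵛ full f s t → Headᵛ full f (bsubst σ s) (subst τ t)
Unbangedᵛ-subst : ∀ {f σ τ s t} → ValueEnvᵛ f σ τ →
                  Unbangedᵛ full f s t → Unbangedᵛ full f (bsubst σ s) (subst τ t)
Bangedᵛ-subst : ∀ {f σ τ s t} → ValueEnvᵛ f σ τ →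
                Bangedᵛ f s t → Bangedᵛ f (bsubst σ s) (subst τ t)
Embᵛ-subst h (var n) = Valueᵛ⇒Embᵛ (h n)
Embᵛ-subst h (lam r) = lam (Embᵛ-subst (Valueᵛ-exts h) r)
Embᵛ-subst h (es p q) = es (Embᵛ-subst (Valueᵛ-exts h) p) (Embᵛ-subst h q)
Embᵛ-subst h (app hd r) = app (Headᵛ-subst h hd) (Embᵛ-subst h r)
Embᵛ-subst h (pending p) = pending (Bangedᵛ-subst h p)
Headᵛ-subst {f} {τ = τ} h (der r d) = der (Embᵛ-subst h r) (DerHead-subst f τ d)
Headᵛ-subst h (unbanged q) = unbanged (Unbangedᵛ-subst h q)
Unbangedᵛ-subst h (var n) = Valueᵛ⇒Unbangedᵛ (h n)
Unbangedᵛ-subst h (lam r) = lam (Embᵛ-subst (Valueᵛ-exts h) r)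
Unbangedᵛ-subst h (es q r) = es (Unbangedᵛ-subst (Valueᵛ-exts h) q) (Embᵛ-subst h r)
Bangedᵛ-subst h (bang r) = bang (Embᵛ-subst h r)
Bangedᵛ-subst h (es p r) = es (Bangedᵛ-subst (Valueᵛ-exts h) p) (Embᵛ-subst h r)

subst⇒sub0 : ∀ {f} (R : BTm → Tm → Set) →
  (∀ {σ τ s t} → ValueEnvᵛ f σ τ → R s t → R (bsubst σ s) (subst τ t)) →
  ∀ k {s t U v} → R s t → Valueᵛ f U v → R (bsub0 k s U) (sub0 k t v)
subst⇒sub0 R R-subst k p val = R-subst h p
  where
  h : ValueEnvᵛ _ _ _
  h zero = val
  h (suc n) = var (k + n)

data Embᵛᴸ (f : Form) : BL → LC → Set where
  []  : Embᵛᴸ f [] []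
  _∷_ : ∀ {s t L L′} → Embᵛ full f s t → Embᵛᴸ f L L′ → Embᵛᴸ f (s ∷ L) (t ∷ L′)

Embᵛᴸ-length : ∀ {f L L′} → Embᵛᴸ f L L′ → length L ≡ length L′
Embᵛᴸ-length [] = refl
Embᵛᴸ-length (_ ∷ l) = cong suc (Embᵛᴸ-length l)

relaxᴸ : ∀ {L L′} → Embᵛᴸ canonical L L′ → Embᵛᴸ pending L L′
relaxᴸ [] = []
relaxᴸ (r ∷ l) = relax r ∷ relaxᴸ l

Embᵛ-plugL : ∀ {f L L′ s t} → Embᵛᴸ f L L′ → Embᵛ full f s t → Embᵛ full f (plugBL L s) (plugL L′ t)
Embᵛ-plugL [] r = r
Embᵛ-plugL (q ∷ l) r = es (Embᵛ-plugL l r) q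

Unbangedᵛ-plugL : ∀ {f L L′ s t} → Embᵛᴸ f L L′ →
                  Unbangedᵛ full f s t → Unbangedᵛ full f (plugBL L s) (plugL L′ t)
Unbangedᵛ-plugL [] r = r
Unbangedᵛ-plugL (q ∷ l) r = es (Unbangedᵛ-plugL l r) q

Bangedᵛ-plugL : ∀ {f L L′ s t} → Embᵛᴸ f L L′ → Bangedᵛ f s t → Bangedᵛ f (plugBL L s) (plugL L′ t)
Bangedᵛ-plugL [] r = r
Bangedᵛ-plugL (q ∷ l) r = es (Bangedᵛ-plugL l r) q

Bangedᵛ-unbang : ∀ {f x t} (L : BL) → Bangedᵛ f (plugBL L (bang x)) t → Embᵛ full f (plugBL L x) t
Bangedᵛ-unbang [] (bang r) = r
Bangedᵛ-unbang (_ ∷ L) (es p r) = es (Bangedᵛ-unbang L p) r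

data ValueUnderᵛ (f : Form) (L : BL) (U : BTm) : Tm → Set where
  valueUnder : ∀ {L′ v} → Embᵛᴸ f L L′ → Valueᵛ f U v → ValueUnderᵛ f L U (plugL L′ v)

Embᵛ-plugBL-bang⁻¹ : ∀ {f U u} (L : BL) → Embᵛ full f (plugBL L (bang U)) u → ValueUnderᵛ f L U u
Embᵛ-plugBL-bang⁻¹ [] (var n) = valueUnder [] (var n)
Embᵛ-plugBL-bang⁻¹ [] (lam r) = valueUnder [] (lam r)
Embᵛ-plugBL-bang⁻¹ (_ ∷ L) (es p q) with Embᵛ-plugBL-bang⁻¹ L p
... | valueUnder l v = valueUnder (q ∷ l) v

data LamUnderᵛ (f : Form) (L : BL) : BTm → Tm → Set where
  lamUnder : ∀ {L′ s t} → Embᵛᴸ f L L′ → Embᵛ full f s t → LamUnderᵛ f L (bang s) (plugL L′ (lam t))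

Unbangedᵛ-plugBL-lam⁻¹ : ∀ {f x t} (L : BL) → Unbangedᵛ full f (plugBL L (lam x)) t → LamUnderᵛ f L x t
Unbangedᵛ-plugBL-lam⁻¹ [] (lam r) = lamUnder [] r
Unbangedᵛ-plugBL-lam⁻¹ (_ ∷ L) (es q r) with Unbangedᵛ-plugBL-lam⁻¹ L q
... | lamUnder l r′ = lamUnder (r ∷ l) r′

Headᵛ-plugBL-lam⁻¹ : ∀ {f x t} (L : BL) → Headᵛ full f (plugBL L (lam x)) t → LamUnderᵛ f L x t
Headᵛ-plugBL-lam⁻¹ [] (unbanged q) = Unbangedᵛ-plugBL-lam⁻¹ [] q
Headᵛ-plugBL-lam⁻¹ (a ∷ L) (unbanged q) = Unbangedᵛ-plugBL-lam⁻¹ (a ∷ L) q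

data ValueUnderᵛᴮ (L : LC) (v : Tm) : BTm → Set where
  valueUnder : ∀ {L′ U} → Embᵛᴸ canonical L′ L → Valueᵛ canonical U v →
               ValueUnderᵛᴮ L v (plugBL L′ (bang U))

Embᵛ-plugL-value⁻¹ : ∀ {v s} (L : LC) → Value v → Embᵛ full canonical s (plugL L v) → ValueUnderᵛᴮ L v s
Embᵛ-plugL-value⁻¹ [] (var n) (var .n) = valueUnder [] (var n)
Embᵛ-plugL-value⁻¹ [] (lam t) (lam r) = valueUnder [] (lam r)
Embᵛ-plugL-value⁻¹ (_ ∷ L) val (es p q) with Embᵛ-plugL-value⁻¹ L val p
... | valueUnder l v = valueUnder (q ∷ l) v

data LamUnderᵛᴮ (L : LC) (t : Tm) : BTm → Set where
  lamUnder : ∀ {L′ s} → Embᵛᴸ canonical L′ L → Embᵛ full canonical s t →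
             LamUnderᵛᴮ L t (plugBL L′ (lam (bang s)))

¬SpineApp-plugL-lam : ∀ {t} (L : LC) → ¬ SpineApp (plugL L (lam t))
¬SpineApp-plugL-lam [] ()
¬SpineApp-plugL-lam (_ ∷ L) (es sa) = ¬SpineApp-plugL-lam L sa

Unbangedᵛ-plugL-lam⁻¹ : ∀ {t s} (L : LC) → Unbangedᵛ full canonical s (plugL L (lam t)) → LamUnderᵛᴮ L t s
Unbangedᵛ-plugL-lam⁻¹ [] (lam r) = lamUnder [] r
Unbangedᵛ-plugL-lam⁻¹ (_ ∷ L) (es q r) with Unbangedᵛ-plugL-lam⁻¹ L q
... | lamUnder l r′ = lamUnder (r ∷ l) r′

Headᵛ-plugL-lam⁻¹ : ∀ {t s} (L : LC) → Headᵛ full canonical s (plugL L (lam t)) → LamUnderᵛᴮ L t s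
Headᵛ-plugL-lam⁻¹ L (der _ sa) = ⊥-elim (¬SpineApp-plugL-lam L sa)
Headᵛ-plugL-lam⁻¹ L (unbanged q) = Unbangedᵛ-plugL-lam⁻¹ L q

toBKindᵛ : VKind → BKind
toBKindᵛ vdB = bdB
toBKindᵛ vsV = bs!

data Reflectᵛ (m : Mode) (R : BTm → Tm → Set) (t : Tm) (s₁ : BTm) : BKind → Set where
  administrative : R s₁ t → Reflectᵛ m R t s₁ bd!
  mirror         : ∀ {k t₁} → VStep m t k t₁ → R s₁ t₁ → Reflectᵛ m R t s₁ (toBKindᵛ k)

map-Reflectᵛ : ∀ {m m′} {R R′ : BTm → Tm → Set} {t s₁ k} (D : Tm → Tm) (C : BTm → BTm) →
  (∀ {s t} → R s t → R′ (C s) (D t)) →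
  (∀ {k t t₁} → VStep m t k t₁ → VStep m′ (D t) k (D t₁)) →
  Reflectᵛ m R t s₁ k → Reflectᵛ m′ R′ (D t) (C s₁) k
map-Reflectᵛ D C f g (administrative r) = administrative (f r)
map-Reflectᵛ D C f g (mirror st r) = mirror (g st) (f r)

SpineApp-step : ∀ {t k t₁} → SpineApp t → VStep internal t k t₁ → SpineApp t₁
SpineApp-step app (ξ-appL _) = app
SpineApp-step app (ξ-appR _) = app
SpineApp-step (es sa) (ξ-esL st) = es (SpineApp-step sa st)
SpineApp-step (es sa) (ξ-esR _) = es sa

reflect-s!ᵛ : ∀ {R : BTm → Tm → Set} (L : BL) {s t x U} →
  (∀ {L₀ L′ s t} → Embᵛᴸ pending L₀ L′ → R s t → R (plugBL L₀ s) (plugL L′ t)) →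
  (∀ k {s t U v} → R s t → Valueᵛ pending U v → R (bsub0 k s U) (sub0 k t v)) →
  R s t → Embᵛ full pending (plugBL L (bang U)) x →
  Reflectᵛ full R (es t x) (plugBL L (bsub0 (length L) s U)) bs!
reflect-s!ᵛ L R-plugL R-sub0 p q with Embᵛ-plugBL-bang⁻¹ L q
... | valueUnder {L′} {v} l val rewrite Embᵛᴸ-length l =
  mirror (root (rsV L′ _ v (Valueᵛ⇒Value val))) (R-plugL l (R-sub0 (length L′) p val))

reflect-rootᵛ : ∀ {k s s₁ t} → BRoot k s s₁ → Embᵛ full pending s t →
                Reflectᵛ full (Embᵛ full pending) t s₁ k
reflect-rootᵛ (rd! [] _) (pending p) = administrative (Bangedᵛ-unbang [] p)
reflect-rootᵛ (rd! (a ∷ L) _) (pending p) = administrative (Bangedᵛ-unbang (a ∷ L) p)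
reflect-rootᵛ (rs! L _ _) (es p q) =
  reflect-s!ᵛ L Embᵛ-plugL (subst⇒sub0 (Embᵛ full pending) Embᵛ-subst) p q

reflect-rootᵁ : ∀ {k s s₁ t} → BRoot k s s₁ → Unbangedᵛ full pending s t →
                Reflectᵛ full (Unbangedᵛ full pending) t s₁ k
reflect-rootᵁ (rs! L _ _) (es q r) =
  reflect-s!ᵛ L Unbangedᵛ-plugL (subst⇒sub0 (Unbangedᵛ full pending) Unbangedᵛ-subst) q r

reflect-rootᴴ : ∀ {k s s₁ t} → BRoot k s s₁ → Headᵛ full pending s t →
                Reflectᵛ full (Headᵛ full pending) t s₁ k
reflect-rootᴴ (rd! L _) (der r _) = administrative (unbanged (Embᵛ-unbang L r))
reflect-rootᴴ (rs! L _ _) (unbanged q) =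
  map-Reflectᵛ (λ t → t) (λ s → s) unbanged (λ st → st) (reflect-rootᵁ (rs! L _ _) q)

reflect-rootᴮ : ∀ {k s s₁ t} → BRoot k s s₁ → Bangedᵛ pending s t →
                Reflectᵛ full (Bangedᵛ pending) t s₁ k
reflect-rootᴮ (rs! L _ _) (es p r) =
  reflect-s!ᵛ L Bangedᵛ-plugL (subst⇒sub0 (Bangedᵛ pending) Bangedᵛ-subst) p r

reflect-derᴴ : ∀ m {t s₁ k} → DerHead m pending t →
               Reflectᵛ m (Embᵛ m pending) t s₁ k → Reflectᵛ m (Headᵛ m pending) t (der s₁) k
reflect-derᴴ full _ (administrative r) = administrative (der r tt)
reflect-derᴴ full _ (mirror st r) = mirror st (der r tt)
reflect-derᴴ internal sa (administrative r) = administrative (der r sa)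
reflect-derᴴ internal sa (mirror st r) = mirror st (der r (SpineApp-step sa st))

reflectᵛ : ∀ {m s t k s₁} → Embᵛ m pending s t → BStep m s k s₁ → Reflectᵛ m (Embᵛ m pending) t s₁ k
reflectᴴ : ∀ {m s t k s₁} → Headᵛ m pending s t → BStep m s k s₁ → Reflectᵛ m (Headᵛ m pending) t s₁ k
reflectᵁ : ∀ {m s t k s₁} → Unbangedᵛ m pending s t → BStep m s k s₁ →
           Reflectᵛ m (Unbangedᵛ m pending) t s₁ k
reflectᴮ : ∀ {s t k s₁} → Bangedᵛ pending s t → BStep full s k s₁ →
           Reflectᵛ full (Bangedᵛ pending) t s₁ k

reflectᵛ p (root r) = reflect-rootᵛ r p
reflectᵛ (var n) (ξ-bang (root ()))
reflectᵛ (lam r) (ξ-bang (root ()))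
reflectᵛ (lam r) (ξ-bang (ξ-lam (root ())))
reflectᵛ (lam r) (ξ-bang (ξ-lam (ξ-bang st))) =
  map-Reflectᵛ lam (λ s → bang (lam (bang s))) lam ξ-lam (reflectᵛ r st)
reflectᵛ (es {s′ = s′} {u = u} p q) (ξ-esL st) =
  map-Reflectᵛ (λ t → es t u) (λ s → es s s′) (λ p′ → es p′ q) ξ-esL (reflectᵛ p st)
reflectᵛ (es {s = s} {t = t} p q) (ξ-esR st) =
  map-Reflectᵛ (es t) (es s) (es p) ξ-esR (reflectᵛ q st)
reflectᵛ (app h r) (ξ-der (root (rdB L _ _))) with Headᵛ-plugBL-lam⁻¹ L h
... | lamUnder {L′} {_} {t₀} l body rewrite Embᵛᴸ-length l =
  mirror (root (rdB L′ t₀ _))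
         (pending (Bangedᵛ-plugL l (es (bang body) (Embᵛ-rename (length L′ +_) r))))
reflectᵛ (app {s′ = s′} {u = u} h r) (ξ-der (ξ-appL st)) =
  map-Reflectᵛ (λ t → app t u) (λ s → der (app s s′)) (λ h′ → app h′ r) ξ-appL (reflectᴴ h st)
reflectᵛ (app {h = h₀} {t = t} h r) (ξ-der (ξ-appR st)) =
  map-Reflectᵛ (app t) (λ s → der (app h₀ s)) (app h) ξ-appR (reflectᵛ r st)
reflectᵛ (pending p) (ξ-der st) = map-Reflectᵛ (λ t → t) der pending (λ st → st) (reflectᴮ p st)

reflectᴴ p (root r) = reflect-rootᴴ r p
reflectᴴ {m} (der r d) (ξ-der st) = reflect-derᴴ m d (reflectᵛ r st)
reflectᴴ (unbanged q) st = map-Reflectᵛ (λ t → t) (λ s → s) unbanged (λ st → st) (reflectᵁ q st)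

reflectᵁ q (root r) = reflect-rootᵁ r q
reflectᵁ (lam r) (ξ-lam (root ()))
reflectᵁ (lam r) (ξ-lam (ξ-bang st)) = map-Reflectᵛ lam (λ s → lam (bang s)) lam ξ-lam (reflectᵛ r st)
reflectᵁ (es {s′ = s′} {u = u} q r) (ξ-esL st) =
  map-Reflectᵛ (λ t → es t u) (λ s → es s s′) (λ q′ → es q′ r) ξ-esL (reflectᵁ q st)
reflectᵁ (es {s = s} {t = t} q r) (ξ-esR st) =
  map-Reflectᵛ (es t) (es s) (es q) ξ-esR (reflectᵛ r st)

reflectᴮ p (root r) = reflect-rootᴮ r p
reflectᴮ (bang r) (ξ-bang st) = map-Reflectᵛ (λ t → t) bang bang (λ st → st) (reflectᵛ r st)
reflectᴮ (es {s′ = s′} {u = u} p r) (ξ-esL st) =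
  map-Reflectᵛ (λ t → es t u) (λ s → es s s′) (λ p′ → es p′ r) ξ-esL (reflectᴮ p st)
reflectᴮ (es {s = s} {t = t} p r) (ξ-esR st) =
  map-Reflectᵛ (es t) (es s) (es p) ξ-esR (reflectᵛ r st)

DerHead-step : ∀ m {t k t₁} → DerHead m canonical t → VStep m t k t₁ → DerHead m pending t₁
DerHead-step full _ _ = tt
DerHead-step internal sa st = SpineApp-step sa st

simulate-sVᵛ : ∀ {R : BTm → Tm → Set} (L : LC) {s t x v} → Value v →
  (∀ {L₀ L′ s t} → Embᵛᴸ canonical L₀ L′ → R s t → R (plugBL L₀ s) (plugL L′ t)) →
  (∀ k {s t U v} → R s t → Valueᵛ canonical U v → R (bsub0 k s U) (sub0 k t v)) →
  R s t → Embᵛ full canonical x (plugL L v) →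
  ∃[ s₁ ] (BStep full (es s x) bs! s₁ × R s₁ (plugL L (sub0 (length L) t v)))
simulate-sVᵛ L val R-plugL R-sub0 p q with Embᵛ-plugL-value⁻¹ L val q
... | valueUnder {L′} {U} l u rewrite sym (Embᵛᴸ-length l) =
  _ , root (rs! L′ _ U) , R-plugL l (R-sub0 (length L′) p u)

simulate-rootᵛ : ∀ {k s t t₁} → VRoot k t t₁ → Embᵛ full canonical s t →
                 ∃[ s₁ ] (BStep full s (toBKindᵛ k) s₁ × Embᵛ full pending s₁ t₁)
simulate-rootᵛ (rdB L _ _) (app h r) with Headᵛ-plugL-lam⁻¹ L h
... | lamUnder {L′} {body} l b rewrite sym (Embᵛᴸ-length l) =
  _ , ξ-der (root (rdB L′ (bang body) _)) ,
  pending (Bangedᵛ-plugL (relaxᴸ l) (es (bang (relax b)) (Embᵛ-rename (length L′ +_) (relax r))))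
simulate-rootᵛ (rsV L _ _ val) (es p q)
  with simulate-sVᵛ L val Embᵛ-plugL (subst⇒sub0 (Embᵛ full canonical) Embᵛ-subst) p q
... | _ , st , r = _ , st , relax r

simulate-rootᵁ : ∀ {k s t t₁} → VRoot k t t₁ → Unbangedᵛ full canonical s t →
                 ∃[ s₁ ] (BStep full s (toBKindᵛ k) s₁ × Unbangedᵛ full pending s₁ t₁)
simulate-rootᵁ (rsV L _ _ val) (es q r)
  with simulate-sVᵛ L val Unbangedᵛ-plugL (subst⇒sub0 (Unbangedᵛ full canonical) Unbangedᵛ-subst) q r
... | _ , st , q′ = _ , st , relaxᵁ q′

simulateᵛ : ∀ {m s t k t₁} → Embᵛ m canonical s t → VStep m t k t₁ →
            ∃[ s₁ ] (BStep m s (toBKindᵛ k) s₁ × Embᵛ m pending s₁ t₁)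
simulateᴴ : ∀ {m s t k t₁} → Headᵛ m canonical s t → VStep m t k t₁ →
            ∃[ s₁ ] (BStep m s (toBKindᵛ k) s₁ × Headᵛ m pending s₁ t₁)
simulateᵁ : ∀ {m s t k t₁} → Unbangedᵛ m canonical s t → VStep m t k t₁ →
            ∃[ s₁ ] (BStep m s (toBKindᵛ k) s₁ × Unbangedᵛ m pending s₁ t₁)
simulateᵛ p (root r) = simulate-rootᵛ r p
simulateᵛ (lam r) (ξ-lam st) with simulateᵛ r st
... | _ , bst , r′ = _ , ξ-bang (ξ-lam (ξ-bang bst)) , lam r′
simulateᵛ (app h r) (ξ-appL st) with simulateᴴ h st
... | _ , bst , h′ = _ , ξ-der (ξ-appL bst) , app h′ (relax r)
simulateᵛ (app h r) (ξ-appR st) with simulateᵛ r st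
... | _ , bst , r′ = _ , ξ-der (ξ-appR bst) , app (relaxᴴ h) r′
simulateᵛ (es p q) (ξ-esL st) with simulateᵛ p st
... | _ , bst , p′ = _ , ξ-esL bst , es p′ (relax q)
simulateᵛ (es p q) (ξ-esR st) with simulateᵛ q st
... | _ , bst , q′ = _ , ξ-esR bst , es (relax p) q′
simulateᴴ {m} (der r d) st with simulateᵛ r st
... | _ , bst , r′ = _ , ξ-der bst , der r′ (DerHead-step m d st)
simulateᴴ (unbanged q) st with simulateᵁ q st
... | _ , bst , q′ = _ , bst , unbanged q′
simulateᵁ q (root r) = simulate-rootᵁ r q
simulateᵁ (lam r) (ξ-lam st) with simulateᵛ r st
... | _ , bst , r′ = _ , ξ-lam (ξ-bang bst) , lam r′
simulateᵁ (es q r) (ξ-esL st) with simulateᵁ q st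
... | _ , bst , q′ = _ , ξ-esL bst , es q′ (relax r)
simulateᵁ (es q r) (ξ-esR st) with simulateᵛ r st
... | _ , bst , r′ = _ , ξ-esR bst , es (relaxᵁ q) r′

D!Steps : Mode → BTm → BTm → Set
D!Steps m = RT.Star (λ s s₁ → BStep m s bd! s₁)

D!Steps-es : ∀ {m s s₂ s′ s₂′} → D!Steps m s s₂ → D!Steps m s′ s₂′ →
             D!Steps m (es s s′) (es s₂ s₂′)
D!Steps-es d₁ d₂ = gmap (λ s → es s _) ξ-esL d₁ ◅◅ gmap (es _) ξ-esR d₂

D!Steps-der-app : ∀ {m h h₂ s′ s₂′} → D!Steps m h h₂ → D!Steps m s′ s₂′ →
                  D!Steps m (der (app h s′)) (der (app h₂ s₂′))
D!Steps-der-app d₁ d₂ = gmap (λ h → der (app h _)) (λ st → ξ-der (ξ-appL st)) d₁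
                     ◅◅ gmap (λ s → der (app _ s)) (λ st → ξ-der (ξ-appR st)) d₂

Bangedᵛ-isBanged : ∀ {f s t} → Bangedᵛ f s t → IsBanged s
Bangedᵛ-isBanged (bang {s = s} _) = banged [] s
Bangedᵛ-isBanged (es {s′ = s′} p _) with Bangedᵛ-isBanged p
... | banged L x = banged (s′ ∷ L) x

normaliseᵛ : ∀ {m s t} → Embᵛ m pending s t → ∃[ s₂ ] (D!Steps m s s₂ × Embᵛ m canonical s₂ t)
normaliseᴴ : ∀ {m s t} → Headᵛ m pending s t → ∃[ s₂ ] (D!Steps m s s₂ × Headᵛ m canonical s₂ t)
normaliseᵁ : ∀ {m s t} → Unbangedᵛ m pending s t → ∃[ s₂ ] (D!Steps m s s₂ × Unbangedᵛ m canonical s₂ t)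
normaliseᴮ : ∀ {s t} → Bangedᵛ pending s t → ∃[ s₂ ] (D!Steps full s s₂ × Bangedᵛ canonical s₂ t)
normalise-derᴴ : ∀ m {s t} → DerHead m pending t → Embᵛ m pending s t →
                 ∃[ s₂ ] (D!Steps m (der s) s₂ × Headᵛ m canonical s₂ t)

normaliseᵛ (var n) = _ , ε , var n
normaliseᵛ (lam r) with normaliseᵛ r
... | _ , d , r₂ = _ , gmap (λ s → bang (lam (bang s))) (λ st → ξ-bang (ξ-lam (ξ-bang st))) d , lam r₂
normaliseᵛ (es p q) with normaliseᵛ p | normaliseᵛ q
... | _ , d₁ , p₂ | _ , d₂ , q₂ = _ , D!Steps-es d₁ d₂ , es p₂ q₂
normaliseᵛ (app h r) with normaliseᴴ h | normaliseᵛ r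
... | _ , d₁ , h₂ | _ , d₂ , r₂ = _ , D!Steps-der-app d₁ d₂ , app h₂ r₂
normaliseᵛ (pending p) with normaliseᴮ p
... | _ , d , p₂ with Bangedᵛ-isBanged p₂
... | banged L x = _ , gmap der ξ-der d ◅◅ (root (rd! L x) ◅ ε) , Bangedᵛ-unbang L p₂

normaliseᴴ {m} (der r d) = normalise-derᴴ m d r
normaliseᴴ (unbanged q) with normaliseᵁ q
... | _ , d , q₂ = _ , d , unbanged q₂

normalise-derᴴ internal sa r with normaliseᵛ r
... | _ , d , r₂ = _ , gmap der ξ-der d , der r₂ sa
normalise-derᴴ full {t = t} _ r with normaliseᵛ r | SpineApp? t
... | _ , d , r₂ | yes sa = _ , gmap der ξ-der d , der r₂ sa
... | _ , d , r₂ | no ¬sa with Embᵛ-isBanged r₂ ¬sa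
... | banged L x = _ , gmap der ξ-der d ◅◅ (root (rd! L x) ◅ ε) , unbanged (Embᵛ-unbang L r₂)

normaliseᵁ (var n) = _ , ε , var n
normaliseᵁ (lam r) with normaliseᵛ r
... | _ , d , r₂ = _ , gmap (λ s → lam (bang s)) (λ st → ξ-lam (ξ-bang st)) d , lam r₂
normaliseᵁ (es q r) with normaliseᵁ q | normaliseᵛ r
... | _ , d₁ , q₂ | _ , d₂ , r₂ = _ , D!Steps-es d₁ d₂ , es q₂ r₂

normaliseᴮ (bang r) with normaliseᵛ r
... | _ , d , r₂ = _ , gmap bang ξ-bang d , bang r₂
normaliseᴮ (es p r) with normaliseᴮ p | normaliseᵛ r
... | _ , d₁ , p₂ | _ , d₂ , r₂ = _ , D!Steps-es d₁ d₂ , es p₂ r₂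

data WithAdmin : List BKind → List VKind → Set where
  []             : WithAdmin [] []
  mirror         : ∀ {tr′ tr} k → WithAdmin tr′ tr → WithAdmin (toBKindᵛ k ∷ tr′) (k ∷ tr)
  administrative : ∀ {tr′ tr} → WithAdmin tr′ tr → WithAdmin (bd! ∷ tr′) tr

cntB-WithAdmin : ∀ {tr′ tr} → WithAdmin tr′ tr → ∀ k → cntB (toBKindᵛ k) tr′ ≡ cntV k tr
cntB-WithAdmin [] k = refl
cntB-WithAdmin (mirror vdB w) vdB = cong suc (cntB-WithAdmin w vdB)
cntB-WithAdmin (mirror vdB w) vsV = cntB-WithAdmin w vsV
cntB-WithAdmin (mirror vsV w) vdB = cntB-WithAdmin w vdB
cntB-WithAdmin (mirror vsV w) vsV = cong suc (cntB-WithAdmin w vsV)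
cntB-WithAdmin (administrative w) vdB = cntB-WithAdmin w vdB
cntB-WithAdmin (administrative w) vsV = cntB-WithAdmin w vsV

CountsMatchᵛ : List BKind → List VKind → Set
CountsMatchᵛ tr′ tr = cntB bdB tr′ ≡ cntV vdB tr × cntB bs! tr′ ≡ cntV vsV tr

counts-WithAdmin : ∀ {tr′ tr} → WithAdmin tr′ tr → CountsMatchᵛ tr′ tr
counts-WithAdmin w = cntB-WithAdmin w vdB , cntB-WithAdmin w vsV

prepend-D!Steps : ∀ {s s₁ s₂ tr′ tr} → D!Steps internal s s₁ → BStar s₁ tr′ s₂ → WithAdmin tr′ tr →
                  ∃[ tr″ ] (BStar s tr″ s₂ × WithAdmin tr″ tr)
prepend-D!Steps ε sts w = _ , sts , w
prepend-D!Steps (st ◅ d) sts w with prepend-D!Steps d sts w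
... | _ , sts′ , w′ = _ , BStep⇒⟶BI st ◅ sts′ , administrative w′

reflectᵛ* : ∀ {s t tr′ s′} → Embᵛ internal pending s t → BStar s tr′ s′ →
            ∃[ tr ] ∃[ t′ ] (VStar t tr t′ × Embᵛ internal pending s′ t′ × WithAdmin tr′ tr)
reflectᵛ* p ε = [] , _ , ε , p , []
reflectᵛ* p (st ◅ sts) with reflectᵛ p (⟶BI⇒BStep st)
... | administrative r with reflectᵛ* r sts
...   | tr , t′ , vsts , r′ , w = tr , t′ , vsts , r′ , administrative w
reflectᵛ* p (st ◅ sts) | mirror {k} vst r with reflectᵛ* r sts
...   | tr , t′ , vsts , r′ , w = k ∷ tr , t′ , VStep⇒⟶VI vst ◅ vsts , r′ , mirror k w

simulateᵛ* : ∀ {s t tr u} → Embᵛ internal canonical s t → VStar t tr u →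
             ∃[ tr′ ] ∃[ s′ ] (BStar s tr′ s′ × Embᵛ internal canonical s′ u × WithAdmin tr′ tr)
simulateᵛ* p ε = [] , _ , ε , p , []
simulateᵛ* p (_◅_ {l = k} st sts) with simulateᵛ p (⟶VI⇒VStep st)
... | _ , bst , r with normaliseᵛ r
... | _ , d , r₂ with simulateᵛ* r₂ sts
... | _ , s′ , bsts , r′ , w with prepend-D!Steps d bsts w
... | _ , bsts′ , w′ = _ , s′ , BStep⇒⟶BI bst ◅ bsts′ , r′ , mirror k w′

stabilityᵛ : ∀ (t : Tm) (s′ : BTm) (tr : List BKind) →
             BStar (t ᵛ) tr s′ → BNF-d! s′ → ∃[ s ] s ᵛ ≡ s′
stabilityᵛ t s′ tr sts nf with reflectᵛ* (relax (Embᵛ-ᵛ internal t)) sts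
... | _ , t′ , _ , r , _ with normaliseᵛ r
... | _ , ε , r₂ = t′ , sym (canonical⇒≡ᵛ r₂)
... | _ , st ◅ _ , _ = ⊥-elim (nf _ (BStep⇒⟶BI st))

normal-formsᵛ : ∀ (t : Tm) → VNF t ⇔ BNF (t ᵛ)
normal-formsᵛ t = mk⇔ to from
  where
  to : VNF t → BNF (t ᵛ)
  to nf k s st with reflectᵛ (relax (Embᵛ-ᵛ internal t)) (⟶BI⇒BStep st)
  ... | administrative _ = canonical-d!-free (Embᵛ-ᵛ internal t) (⟶BI⇒BStep st)
  ... | mirror vst _ = nf _ _ (VStep⇒⟶VI vst)
  from : BNF (t ᵛ) → VNF t
  from nf k u st with simulateᵛ (Embᵛ-ᵛ internal t) (⟶VI⇒VStep st)
  ... | _ , bst , _ = nf _ _ (BStep⇒⟶BI bst)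

simulationᵛ : ∀ (t u : Tm) →
  (∀ (tr : List VKind) → VStar t tr u → ∃[ tr′ ] (BStar (t ᵛ) tr′ (u ᵛ) × CountsMatchᵛ tr′ tr))
  × (∀ (tr′ : List BKind) → BStar (t ᵛ) tr′ (u ᵛ) → ∃[ tr ] (VStar t tr u × CountsMatchᵛ tr′ tr))
simulationᵛ t u = forward , backward
  where
  forward : ∀ tr → VStar t tr u → ∃[ tr′ ] (BStar (t ᵛ) tr′ (u ᵛ) × CountsMatchᵛ tr′ tr)
  forward tr vsts with simulateᵛ* (Embᵛ-ᵛ internal t) vsts
  ... | tr′ , _ , bsts , r , w rewrite canonical⇒≡ᵛ r = tr′ , bsts , counts-WithAdmin w
  backward : ∀ tr′ → BStar (t ᵛ) tr′ (u ᵛ) → ∃[ tr ] (VStar t tr u × CountsMatchᵛ tr′ tr)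
  backward tr′ bsts with reflectᵛ* (relax (Embᵛ-ᵛ internal t)) bsts
  ... | tr , _ , vsts , r , w with normaliseᵛ r
  ... | _ , st ◅ _ , _ = ⊥-elim (canonical-d!-free (Embᵛ-ᵛ internal u) st)
  ... | _ , ε , r₂ rewrite Embᵛ-functional r₂ (Embᵛ-ᵛ internal u) = tr , vsts , counts-WithAdmin w

corollary8 :
    (∀ (t : Tm) (s' : BTm) (tr : List BKind) → BStar (t ⁿ) tr s' → ∃[ s ] s ⁿ ≡ s')
    × (∀ (t : Tm) (s' : BTm) (tr : List BKind) → BStar (t ᵛ) tr s' → BNF-d! s' → ∃[ s ] s ᵛ ≡ s')
    × (∀ (t : Tm) → NNF t ⇔ BNF (t ⁿ))
    × (∀ (t : Tm) → VNF t ⇔ BNF (t ᵛ))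
    × (∀ (t u : Tm) →
        (∀ (tr : List NKind) → NStar t tr u →
          ∃[ tr' ] (BStar (t ⁿ) tr' (u ⁿ) × cntB bdB tr' ≡ cntN ndB tr × cntB bs! tr' ≡ cntN ns tr))
        × (∀ (tr' : List BKind) → BStar (t ⁿ) tr' (u ⁿ) →
          ∃[ tr ] (NStar t tr u × cntB bdB tr' ≡ cntN ndB tr × cntB bs! tr' ≡ cntN ns tr)))
    × (∀ (t u : Tm) →
        (∀ (tr : List VKind) → VStar t tr u →
          ∃[ tr' ] (BStar (t ᵛ) tr' (u ᵛ) × cntB bdB tr' ≡ cntV vdB tr × cntB bs! tr' ≡ cntV vsV tr))
        × (∀ (tr' : List BKind) → BStar (t ᵛ) tr' (u ᵛ) →
          ∃[ tr ] (VStar t tr u × cntB bdB tr' ≡ cntV vdB tr × cntB bs! tr' ≡ cntV vsV tr)))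
corollary8 = stabilityⁿ , stabilityᵛ , normal-formsⁿ , normal-formsᵛ , simulationⁿ , simulationᵛ
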